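{- Let $q$ be a prime power, let $1<k<n-1$, and let $V=F_q^n$. Let $U\subseteq V$ be a $(k+1)$-dimensional non-degenerate linear code with generator matrix $M$ (a $(k+1)\times n$ matrix whose rows form a basis of $U$). Let $W'\subseteq F_q^{k+1}$ be the set of all non-zero vectors not proportional to any column of $M$, and let $W$ be the subspace of $F_q^{k+1}$ spanned by $W'$. Let $\langle U]^c_k$ denote the set of all $k$-dimensional subspaces of $U$ that are non-degenerate linear codes. Then $\langle U]^c_k$ is contained in a line of $\mathcal G_k(V)$ if and only if $\dim W\leqslant 2$.
   Context: $F_q$ is the field with $q$ elements; $\mathcal G_k(V)$ is the set of all $k$-dimensional subspaces of $V$. For $i=1,\dots,n$, $C_i$ is the coordinate hyperplane $\{x\in V: x_i=0\}$. A subspace of $V$ is a non-degenerate linear code if it is not contained in any $C_i$. A line of $\mathcal G_k(V)$ is a set $[S,T]_k=\{K\in\mathcal G_k(V): S\subset K\subset T\}$ where $S\subset T$ are subspaces of $V$ with $\dim S=k-1$ and $\dim T=k+1$. -}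

module Defs where

open import Level using (Level; _⊔_; Lift) renaming (suc to lsuc)
open import Data.Nat using (ℕ; zero; suc; _≤_; _^_; _∸_)
open import Data.Nat.Primality using (Prime)
open import Data.Fin using (Fin) renaming (zero to fzero; suc to fsuc)
open import Data.Product using (Σ; ∃; _×_; _,_)
open import Relation.Nullary using (¬_)
open import Relation.Unary using (Pred)
open import Relation.Binary.PropositionalEquality using (_≡_)
open import Algebra.Bundles using (CommutativeRing)

IsPrimePower : ℕ → Set
IsPrimePower q = Σ ℕ λ p → Σ ℕ λ e → Prime p × q ≡ p ^ suc e

record FiniteField (c ℓ : Level) : Set (lsuc (c ⊔ ℓ)) where
  field
    commRing : CommutativeRing c ℓ
  open CommutativeRing commRing public
  field
    1≉0     : ¬ (1# ≈ 0#)
    inverse : ∀ x → ¬ (x ≈ 0#) → Σ Carrier λ y → x * y ≈ 1#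
    q       : ℕ
    enum    : Fin q → Carrier
    enum-surjective : ∀ x → Σ (Fin q) λ i → enum i ≈ x
    enum-injective  : ∀ i j → enum i ≈ enum j → i ≡ j

module LinAlg {c ℓ : Level} (F : FiniteField c ℓ) where
  open FiniteField F

  Vec : ℕ → Set c
  Vec n = Fin n → Carrier

  sumF : (m : ℕ) → (Fin m → Carrier) → Carrier
  sumF zero    f = 0#
  sumF (suc m) f = f fzero + sumF m (λ i → f (fsuc i))

  lincomb : ∀ {m n} → (Fin m → Carrier) → (Fin m → Vec n) → Vec n
  lincomb {m} a v j = sumF m (λ i → a i * v i j)

  _≈v_ : ∀ {n} → Vec n → Vec n → Set ℓ
  x ≈v y = ∀ j → x j ≈ y j

  zeroV : ∀ {n} → Vec n
  zeroV _ = 0#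

  LinIndep : ∀ {m n} → (Fin m → Vec n) → Set (c ⊔ ℓ)
  LinIndep {m} v = ∀ (a : Fin m → Carrier) → lincomb a v ≈v zeroV → ∀ i → a i ≈ 0#

  InSpan : ∀ {m n} → (Fin m → Vec n) → Pred (Vec n) (c ⊔ ℓ)
  InSpan {m} v x = Σ (Fin m → Carrier) λ a → x ≈v lincomb a v

  Subset : ℕ → Set (lsuc (c ⊔ ℓ))
  Subset n = Pred (Vec n) (c ⊔ ℓ)

  _⊆_ : ∀ {n} → Subset n → Subset n → Set (c ⊔ ℓ)
  A ⊆ B = ∀ x → A x → B x

  IsBasis : ∀ {m n} → (Fin m → Vec n) → Subset n → Set (c ⊔ ℓ)
  IsBasis b S = LinIndep b × (∀ x → (S x → InSpan b x) × (InSpan b x → S x))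

  HasDim : ∀ {n} → Subset n → ℕ → Set (c ⊔ ℓ)
  HasDim {n} S k = Σ (Fin k → Vec n) λ b → IsBasis b S

  SpanOf : ∀ {n} → Subset n → Subset n
  SpanOf {n} P x = Σ ℕ λ m → Σ (Fin m → Vec n) λ v → (∀ i → P (v i)) × InSpan v x

  C : ∀ {n} → Fin n → Subset n
  C {n} i x = Lift (c ⊔ ℓ) (x i ≈ 0#)

  NonDegenerate : ∀ {n} → Subset n → Set (c ⊔ ℓ)
  NonDegenerate {n} K = ∀ (i : Fin n) → ¬ (K ⊆ C i)

  Proportional : ∀ {m} → Vec m → Vec m → Set (c ⊔ ℓ)
  Proportional u v = Σ Carrier λ a → ∀ i → u i ≈ a * v i

  column : ∀ {k n} → (Fin k → Vec n) → Fin n → Vec k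
  column M j i = M i j

  W′ : ∀ {k n} → (Fin k → Vec n) → Subset k
  W′ {k} {n} M w = ¬ (w ≈v zeroV {k}) × (∀ (j : Fin n) → ¬ Proportional w (column M j))

  W : ∀ {k n} → (Fin k → Vec n) → Subset k
  W M = SpanOf (W′ M)

  NonDegSubOf : ∀ {n} → Subset n → ℕ → Subset n → Set (c ⊔ ℓ)
  NonDegSubOf U k K = HasDim K k × K ⊆ U × NonDegenerate K

  -- a family 𝒦 of k-subspaces (k ≥ 1) is contained in a line [S,T]_k of G_k(F^n)
  ContainedInLine : ∀ {n} → ℕ → (Subset n → Set (c ⊔ ℓ)) → Set (lsuc (c ⊔ ℓ))
  ContainedInLine {n} k 𝒦 =
    Σ (Subset n) λ S → Σ (Subset n) λ T →
      HasDim S (k ∸ 1) × HasDim T (suc k) × S ⊆ T ×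
      (∀ K → 𝒦 K → HasDim K k × S ⊆ K × K ⊆ T)

module Submission where

-- Write the elements of U as φ a = a M with coordinates a ∈ F^(k+1). The k-dimensional subspaces of U
-- are the images of the hyperplanes {a | a ⟂ w} with w ≠ 0, and such an image is a non-degenerate code
-- exactly when w is not proportional to a column of M, i.e. when w ∈ W′. So if a line [S,T]_k contains
-- all of them, S has k - 1 independent coordinate vectors orthogonal to all of W′. Independent families
-- orthogonal to each other in F^(k+1) have total size at most k + 1 (even though vectors may be
-- orthogonal to themselves), so W′ contains at most two independent vectors. Conversely, if dim W ≤ 2,
-- then k - 1 independent vectors orthogonal to W span, through φ, an S with every such code in [S,U]_k.

open import Defs
open import Level using (Level; _⊔_; lift; lower)
open import Data.Nat as ℕ using (ℕ; zero; suc; _≤_; _≤′_; ≤′-refl; ≤′-step; s≤s; z≤n)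
import Data.Nat.Properties as ℕ
open import Data.Integer as ℤ using (ℤ; -[1+_]; _⊖_; _◃_; sign; ∣_∣)
import Data.Integer.Properties as ℤ
open import Data.Sign as Sign using (Sign)
open import Data.Fin as Fin using (Fin; punchIn) renaming (zero to fzero; suc to fsuc)
import Data.Fin.Properties as Fin
open import Data.Vec.Functional using ([]; _∷_; head; tail; insertAt)
import Data.Vec.Functional.Properties as Vector
open import Data.Product using (Σ; ∃; _×_; _,_; proj₁; proj₂)
open import Data.Maybe using (Maybe; just; nothing)
open import Data.Empty using (⊥-elim)
open import Function using (_∘_; id)
open import Function.Bundles using (_⇔_; mk⇔)
open import Relation.Nullary using (Dec; yes; no; ¬_)
open import Relation.Nullary.Decidable using (¬?; _×-dec_)
import Relation.Unary as U
open import Relation.Binary.Definitions using (Decidable; _Respects_)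
open import Relation.Binary.PropositionalEquality as ≡ using (_≡_; _≢_)
open import Algebra.Bundles using (CommutativeRing; RawRing)
open import Algebra.Solver.Ring.AlmostCommutativeRing using (fromCommutativeRing; _-Raw-AlmostCommutative⟶_)
import Algebra.Solver.Ring as RingSolver

-- The ring solver needs a coefficient ring with decidable equality and a morphism into the target;
-- ℤ, acting by n ↦ n · 1#, serves every commutative ring.
module IntegerCoefficients {c ℓ : Level} (R : CommutativeRing c ℓ) where
  open CommutativeRing R
  open import Algebra.Properties.Ring ring
    using (-‿involutive; -0#≈0#; -‿distribˡ-*; -‿distribʳ-*; -‿+-comm)
  open import Algebra.Properties.Semiring.Mult semiring using (×-homo-+; ×1-homo-*) renaming (_×_ to _×ᵣ_)
  open import Relation.Binary.Reasoning.Setoid setoid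

  ⟦_⟧ : ℤ → Carrier
  ⟦ ℤ.+ n ⟧    = n ×ᵣ 1#
  ⟦ -[1+ n ] ⟧ = - (suc n ×ᵣ 1#)

  private
    x-y≈[1+x]-[1+y] : ∀ x y → x - y ≈ (1# + x) - (1# + y)
    x-y≈[1+x]-[1+y] x y = sym (begin
      (1# + x) - (1# + y)       ≈⟨ +-congˡ (sym (-‿+-comm 1# y)) ⟩
      (1# + x) + (- 1# + - y)   ≈⟨ +-congʳ (+-comm 1# x) ⟩
      (x + 1#) + (- 1# + - y)   ≈⟨ +-assoc x 1# _ ⟩
      x + (1# + (- 1# + - y))   ≈⟨ +-congˡ (sym (+-assoc 1# (- 1#) (- y))) ⟩
      x + ((1# - 1#) + - y)     ≈⟨ +-congˡ (+-congʳ (-‿inverseʳ 1#)) ⟩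
      x + (0# + - y)            ≈⟨ +-congˡ (+-identityˡ (- y)) ⟩
      x - y                     ∎)

    sgn : Sign → Carrier → Carrier
    sgn Sign.+ x = x
    sgn Sign.- x = - x

    sgn-cong : ∀ s {x y} → x ≈ y → sgn s x ≈ sgn s y
    sgn-cong Sign.+ x≈y = x≈y
    sgn-cong Sign.- x≈y = -‿cong x≈y

    sgn-* : ∀ s t x y → sgn (s Sign.* t) (x * y) ≈ sgn s x * sgn t y
    sgn-* Sign.+ Sign.+ x y = refl
    sgn-* Sign.+ Sign.- x y = -‿distribʳ-* x y
    sgn-* Sign.- Sign.+ x y = -‿distribˡ-* x y
    sgn-* Sign.- Sign.- x y = begin
      x * y           ≈⟨ sym (-‿involutive (x * y)) ⟩
      - - (x * y)     ≈⟨ -‿cong (-‿distribʳ-* x y) ⟩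
      - (x * - y)     ≈⟨ -‿distribˡ-* x (- y) ⟩
      - x * - y       ∎

    ⟦◃⟧ : ∀ s n → ⟦ s ◃ n ⟧ ≈ sgn s (n ×ᵣ 1#)
    ⟦◃⟧ Sign.+ zero    = refl
    ⟦◃⟧ Sign.- zero    = sym -0#≈0#
    ⟦◃⟧ Sign.+ (suc n) = refl
    ⟦◃⟧ Sign.- (suc n) = refl

    ⟦sign◃abs⟧ : ∀ i → ⟦ i ⟧ ≈ sgn (sign i) (∣ i ∣ ×ᵣ 1#)
    ⟦sign◃abs⟧ (ℤ.+ n)  = refl
    ⟦sign◃abs⟧ -[1+ n ] = refl

    ⟦⊖⟧ : ∀ m n → ⟦ m ⊖ n ⟧ ≈ m ×ᵣ 1# - n ×ᵣ 1#
    ⟦⊖⟧ zero    zero    = sym (-‿inverseʳ 0#)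
    ⟦⊖⟧ zero    (suc n) = sym (+-identityˡ _)
    ⟦⊖⟧ (suc m) zero    = sym (trans (+-congˡ -0#≈0#) (+-identityʳ _))
    ⟦⊖⟧ (suc m) (suc n) = begin
      ⟦ suc m ⊖ suc n ⟧          ≡⟨ ≡.cong ⟦_⟧ (ℤ.[1+m]⊖[1+n]≡m⊖n m n) ⟩
      ⟦ m ⊖ n ⟧                  ≈⟨ ⟦⊖⟧ m n ⟩
      m ×ᵣ 1# - n ×ᵣ 1#          ≈⟨ x-y≈[1+x]-[1+y] _ _ ⟩
      suc m ×ᵣ 1# - suc n ×ᵣ 1#  ∎

  ⟦+⟧ : ∀ i j → ⟦ i ℤ.+ j ⟧ ≈ ⟦ i ⟧ + ⟦ j ⟧
  ⟦+⟧ (ℤ.+ m)  (ℤ.+ n)  = ×-homo-+ 1# m n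
  ⟦+⟧ (ℤ.+ m)  -[1+ n ] = ⟦⊖⟧ m (suc n)
  ⟦+⟧ -[1+ m ] (ℤ.+ n)  = trans (⟦⊖⟧ n (suc m)) (+-comm _ _)
  ⟦+⟧ -[1+ m ] -[1+ n ] = begin
    - (suc (suc (m ℕ.+ n)) ×ᵣ 1#)      ≡⟨ ≡.cong (λ k → - (suc k ×ᵣ 1#)) (≡.sym (ℕ.+-suc m n)) ⟩
    - ((suc m ℕ.+ suc n) ×ᵣ 1#)        ≈⟨ -‿cong (×-homo-+ 1# (suc m) (suc n)) ⟩
    - (suc m ×ᵣ 1# + suc n ×ᵣ 1#)      ≈⟨ sym (-‿+-comm _ _) ⟩
    - (suc m ×ᵣ 1#) + - (suc n ×ᵣ 1#)  ∎

  ⟦*⟧ : ∀ i j → ⟦ i ℤ.* j ⟧ ≈ ⟦ i ⟧ * ⟦ j ⟧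
  ⟦*⟧ i j = begin
    ⟦ s ◃ ∣ i ∣ ℕ.* ∣ j ∣ ⟧                                  ≈⟨ ⟦◃⟧ s (∣ i ∣ ℕ.* ∣ j ∣) ⟩
    sgn s ((∣ i ∣ ℕ.* ∣ j ∣) ×ᵣ 1#)                          ≈⟨ sgn-cong s (×1-homo-* ∣ i ∣ ∣ j ∣) ⟩
    sgn s (∣ i ∣ ×ᵣ 1# * ∣ j ∣ ×ᵣ 1#)                         ≈⟨ sgn-* (sign i) (sign j) _ _ ⟩
    sgn (sign i) (∣ i ∣ ×ᵣ 1#) * sgn (sign j) (∣ j ∣ ×ᵣ 1#)  ≈⟨ sym (*-cong (⟦sign◃abs⟧ i) (⟦sign◃abs⟧ j)) ⟩
    ⟦ i ⟧ * ⟦ j ⟧                                            ∎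
    where s = sign i Sign.* sign j

  ⟦-⟧ : ∀ i → ⟦ ℤ.- i ⟧ ≈ - ⟦ i ⟧
  ⟦-⟧ (ℤ.+ zero)  = sym -0#≈0#
  ⟦-⟧ (ℤ.+ suc n) = refl
  ⟦-⟧ -[1+ n ]    = sym (-‿involutive _)

  private
    ℤ-rawRing : RawRing _ _
    ℤ-rawRing = record
      { Carrier = ℤ ; _≈_ = _≡_ ; _+_ = ℤ._+_ ; _*_ = ℤ._*_ ; -_ = ℤ.-_ ; 0# = ℤ.+ 0 ; 1# = ℤ.+ 1 }

    ⟦⟧-morphism : ℤ-rawRing -Raw-AlmostCommutative⟶ fromCommutativeRing R
    ⟦⟧-morphism = record
      { ⟦_⟧ = ⟦_⟧ ; +-homo = ⟦+⟧ ; *-homo = ⟦*⟧ ; -‿homo = ⟦-⟧ ; 0-homo = refl ; 1-homo = +-identityʳ 1# }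

    ⟦⟧-≟ : ∀ i j → Maybe (⟦ i ⟧ ≈ ⟦ j ⟧)
    ⟦⟧-≟ i j with i ℤ.≟ j
    ... | yes i≡j = just (reflexive (≡.cong ⟦_⟧ i≡j))
    ... | no _    = nothing

  open RingSolver ℤ-rawRing (fromCommutativeRing R) ⟦⟧-morphism ⟦⟧-≟ public
    using (solve; _:=_; _:+_; _:*_; :-_; _:-_; con)

module LinearAlgebra {c ℓ : Level} (F : FiniteField c ℓ) where
  open FiniteField F public
  open LinAlg F public
  open IntegerCoefficients commRing
  open import Algebra.Properties.Ring ring using (-0#≈0#; -‿+-comm; -‿distribˡ-*; [y-z]x≈yx-zx; x∙y⁻¹≈ε⇒x≈y)
  open import Algebra.Properties.Semiring.Sum semiring
    using (sum; sum-cong-≋; sum-cong-≗; ∑-distrib-+; ∑-comm; *-distribˡ-sum; *-distribʳ-sum; sum-remove)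
  open import Algebra.Properties.CommutativeSemigroup *-commutativeSemigroup public using (x∙yz≈y∙xz)
  open import Relation.Binary.Reasoning.Setoid setoid public

  infix 4 _≈?_
  _≈?_ : Decidable _≈_
  x ≈? y with enum-surjective x | enum-surjective y
  ... | i , eᵢ≈x | j , eⱼ≈y with i Fin.≟ j
  ...   | yes ≡.refl = yes (trans (sym eᵢ≈x) eⱼ≈y)
  ...   | no i≢j     = no (λ x≈y → i≢j (enum-injective i j (trans eᵢ≈x (trans x≈y (sym eⱼ≈y)))))

  cancel-nonzeroˡ : ∀ {x y} → x ≉ 0# → x * y ≈ 0# → y ≈ 0#
  cancel-nonzeroˡ {x} {y} x≉0 xy≈0 = begin
    y                ≈⟨ sym (*-identityˡ y) ⟩
    1# * y           ≈⟨ *-congʳ (sym xx⁻¹≈1) ⟩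
    (x * x⁻¹) * y    ≈⟨ solve 3 (λ x x⁻¹ y → (x :* x⁻¹) :* y := x⁻¹ :* (x :* y)) refl x x⁻¹ y ⟩
    x⁻¹ * (x * y)    ≈⟨ *-congˡ xy≈0 ⟩
    x⁻¹ * 0#         ≈⟨ zeroʳ x⁻¹ ⟩
    0#               ∎
    where
    x⁻¹ = proj₁ (inverse x x≉0)
    xx⁻¹≈1 = proj₂ (inverse x x≉0)

  *-nonzero : ∀ {x y} → x ≉ 0# → y ≉ 0# → x * y ≉ 0#
  *-nonzero x≉0 y≉0 xy≈0 = y≉0 (cancel-nonzeroˡ x≉0 xy≈0)

  sumF≡sum : ∀ m (f : Fin m → Carrier) → sumF m f ≡ sum f
  sumF≡sum zero    f = ≡.refl
  sumF≡sum (suc m) f = ≡.cong (f fzero +_) (sumF≡sum m (f ∘ fsuc))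

  sumF-cong : ∀ m {f g : Fin m → Carrier} → (∀ i → f i ≈ g i) → sumF m f ≈ sumF m g
  sumF-cong m {f} {g} f≈g rewrite sumF≡sum m f | sumF≡sum m g = sum-cong-≋ f≈g

  sumF-zero : ∀ m {f : Fin m → Carrier} → (∀ i → f i ≈ 0#) → sumF m f ≈ 0#
  sumF-zero zero    f≈0 = refl
  sumF-zero (suc m) f≈0 = trans (+-cong (f≈0 fzero) (sumF-zero m (f≈0 ∘ fsuc))) (+-identityʳ 0#)

  sumF-+ : ∀ m (f g : Fin m → Carrier) → sumF m (λ i → f i + g i) ≈ sumF m f + sumF m g
  sumF-+ m f g rewrite sumF≡sum m (λ i → f i + g i) | sumF≡sum m f | sumF≡sum m g = ∑-distrib-+ f g

  sumF-*ˡ : ∀ m x (f : Fin m → Carrier) → x * sumF m f ≈ sumF m (λ i → x * f i)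
  sumF-*ˡ m x f rewrite sumF≡sum m f | sumF≡sum m (λ i → x * f i) = *-distribˡ-sum x f

  sumF-*ʳ : ∀ m x (f : Fin m → Carrier) → sumF m f * x ≈ sumF m (λ i → f i * x)
  sumF-*ʳ m x f rewrite sumF≡sum m f | sumF≡sum m (λ i → f i * x) = *-distribʳ-sum x f

  sumF-neg : ∀ m (f : Fin m → Carrier) → - sumF m f ≈ sumF m (λ i → - f i)
  sumF-neg zero    f = -0#≈0#
  sumF-neg (suc m) f = trans (sym (-‿+-comm _ _)) (+-congˡ (sumF-neg m (f ∘ fsuc)))

  sumF-comm : ∀ m p (f : Fin m → Fin p → Carrier) →
    sumF m (λ i → sumF p (f i)) ≈ sumF p (λ j → sumF m (λ i → f i j))
  sumF-comm m p f = begin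
    sumF m (λ i → sumF p (f i))       ≡⟨ ≡.trans (sumF≡sum m _) (sum-cong-≗ (λ i → sumF≡sum p (f i))) ⟩
    sum (λ i → sum (f i))             ≈⟨ ∑-comm f ⟩
    sum (λ j → sum (λ i → f i j))     ≡⟨ ≡.sym (≡.trans (sumF≡sum p _) (sum-cong-≗ (λ j → sumF≡sum m (λ i → f i j)))) ⟩
    sumF p (λ j → sumF m (λ i → f i j)) ∎

  sumF-punchIn : ∀ m (c : Fin (suc m)) (f : Fin (suc m) → Carrier) →
    sumF (suc m) f ≈ f c + sumF m (f ∘ punchIn c)
  sumF-punchIn m c f rewrite sumF≡sum (suc m) f | sumF≡sum m (f ∘ punchIn c) = sum-remove f

  ≈v-refl : ∀ {m} {x : Vec m} → x ≈v x
  ≈v-refl j = refl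

  ≈v-sym : ∀ {m} {x y : Vec m} → x ≈v y → y ≈v x
  ≈v-sym x≈y j = sym (x≈y j)

  ≈v-trans : ∀ {m} {x y z : Vec m} → x ≈v y → y ≈v z → x ≈v z
  ≈v-trans x≈y y≈z j = trans (x≈y j) (y≈z j)

  ≈v-punchIn : ∀ {m} (c : Fin (suc m)) {x y : Vec (suc m)} →
    x c ≈ y c → (∀ j → x (punchIn c j) ≈ y (punchIn c j)) → x ≈v y
  ≈v-punchIn c {x} {y} x≈y-at-c x≈y-elsewhere i with c Fin.≟ i
  ... | yes ≡.refl = x≈y-at-c
  ... | no c≢i     = ≡.subst (λ i → x i ≈ y i) (Fin.punchIn-punchOut c≢i) (x≈y-elsewhere _)

  lincomb-cong : ∀ {m n} {a a′ : Fin m → Carrier} {v v′ : Fin m → Vec n} →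
    (∀ i → a i ≈ a′ i) → (∀ i → v i ≈v v′ i) → lincomb a v ≈v lincomb a′ v′
  lincomb-cong {m} a≈a′ v≈v′ j = sumF-cong m (λ i → *-cong (a≈a′ i) (v≈v′ i j))

  lincomb-assoc : ∀ {m p n} (a : Fin m → Carrier) (β : Fin m → Fin p → Carrier) (b : Fin p → Vec n) →
    lincomb a (λ i → lincomb (β i) b) ≈v lincomb (λ l → sumF m (λ i → a i * β i l)) b
  lincomb-assoc {m} {p} a β b j = begin
    sumF m (λ i → a i * sumF p (λ l → β i l * b l j))   ≈⟨ sumF-cong m (λ i → sumF-*ˡ p (a i) _) ⟩
    sumF m (λ i → sumF p (λ l → a i * (β i l * b l j))) ≈⟨ sumF-comm m p _ ⟩
    sumF p (λ l → sumF m (λ i → a i * (β i l * b l j))) ≈⟨ sumF-cong p (λ l → sumF-cong m (λ i → sym (*-assoc _ _ _))) ⟩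
    sumF p (λ l → sumF m (λ i → (a i * β i l) * b l j)) ≈⟨ sumF-cong p (λ l → sym (sumF-*ʳ m (b l j) _)) ⟩
    sumF p (λ l → sumF m (λ i → a i * β i l) * b l j)   ∎

  dot : ∀ {m} → Vec m → Vec m → Carrier
  dot {m} a b = sumF m (λ i → a i * b i)

  infix 4 _⟂_
  _⟂_ : ∀ {m} → Vec m → Vec m → Set ℓ
  u ⟂ v = dot u v ≈ 0#

  dot-comm : ∀ {m} (a b : Vec m) → dot a b ≈ dot b a
  dot-comm {m} a b = sumF-cong m (λ i → *-comm (a i) (b i))

  ⟂-sym : ∀ {m} (a b : Vec m) → a ⟂ b → b ⟂ a
  ⟂-sym a b a⟂b = trans (dot-comm b a) a⟂b

  dot-congˡ : ∀ {m} {a a′ : Vec m} (b : Vec m) → a ≈v a′ → dot a b ≈ dot a′ b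
  dot-congˡ {m} b a≈a′ = sumF-cong m (λ i → *-congʳ (a≈a′ i))

  dot-congʳ : ∀ {m} (a : Vec m) {b b′ : Vec m} → b ≈v b′ → dot a b ≈ dot a b′
  dot-congʳ {m} a b≈b′ = sumF-cong m (λ i → *-congˡ (b≈b′ i))

  ⟂-zeroʳ : ∀ {m} (a : Vec m) {b : Vec m} → b ≈v zeroV → a ⟂ b
  ⟂-zeroʳ {m} a b≈0 = sumF-zero m (λ i → trans (*-congˡ (b≈0 i)) (zeroʳ (a i)))

  dot-punchIn : ∀ {m} (c : Fin (suc m)) (a b : Vec (suc m)) →
    dot a b ≈ a c * b c + dot (a ∘ punchIn c) (b ∘ punchIn c)
  dot-punchIn {m} c a b = sumF-punchIn m c (λ i → a i * b i)

  dot-lincombʳ : ∀ {m t} (u : Vec m) (β : Fin t → Carrier) (w : Fin t → Vec m) →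
    dot u (lincomb β w) ≈ sumF t (λ i → β i * dot u (w i))
  dot-lincombʳ {m} {t} u β w = begin
    sumF m (λ x → u x * sumF t (λ i → β i * w i x))   ≈⟨ sumF-cong m (λ x → sumF-*ˡ t (u x) _) ⟩
    sumF m (λ x → sumF t (λ i → u x * (β i * w i x))) ≈⟨ sumF-comm m t _ ⟩
    sumF t (λ i → sumF m (λ x → u x * (β i * w i x))) ≈⟨ sumF-cong t (λ i → sumF-cong m (λ x → x∙yz≈y∙xz _ _ _)) ⟩
    sumF t (λ i → sumF m (λ x → β i * (u x * w i x))) ≈⟨ sumF-cong t (λ i → sym (sumF-*ˡ m (β i) _)) ⟩
    sumF t (λ i → β i * dot u (w i))                  ∎

  ⟂-lincombʳ : ∀ {m t} (u : Vec m) (β : Fin t → Carrier) (w : Fin t → Vec m) →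
    (∀ i → u ⟂ w i) → u ⟂ lincomb β w
  ⟂-lincombʳ {t = t} u β w u⟂w =
    trans (dot-lincombʳ u β w) (sumF-zero t (λ i → trans (*-congˡ (u⟂w i)) (zeroʳ (β i))))

  ⟂-lincombˡ : ∀ {m t} (β : Fin t → Carrier) (w : Fin t → Vec m) (u : Vec m) →
    (∀ i → w i ⟂ u) → lincomb β w ⟂ u
  ⟂-lincombˡ β w u w⟂u = ⟂-sym u (lincomb β w) (⟂-lincombʳ u β w (λ i → ⟂-sym (w i) u (w⟂u i)))

  unit : ∀ {m} → Fin m → Vec m
  unit i j with i Fin.≟ j
  ... | yes _ = 1#
  ... | no  _ = 0#

  sumF-*unit : ∀ m (f : Fin m → Carrier) (i : Fin m) → sumF m (λ l → f l * unit l i) ≈ f i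
  sumF-*unit (suc m) f i = begin
    sumF (suc m) (λ l → f l * unit l i)                         ≈⟨ sumF-punchIn m i (λ l → f l * unit l i) ⟩
    f i * unit i i + sumF m (λ l → f (punchIn i l) * unit (punchIn i l) i)
                                                                 ≈⟨ +-cong (*-unitᵢᵢ) (sumF-zero m (λ l → *-unit≢ (Fin.punchInᵢ≢i i l))) ⟩
    f i + 0#                                                     ≈⟨ +-identityʳ (f i) ⟩
    f i                                                          ∎
    where
    *-unitᵢᵢ : f i * unit i i ≈ f i
    *-unitᵢᵢ with i Fin.≟ i
    ... | yes _  = *-identityʳ (f i)
    ... | no i≢i = ⊥-elim (i≢i ≡.refl)
    *-unit≢ : ∀ {l} → l ≢ i → f l * unit l i ≈ 0#
    *-unit≢ {l} l≢i with l Fin.≟ i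
    ... | yes l≡i = ⊥-elim (l≢i l≡i)
    ... | no  _   = zeroʳ (f l)

  unit-LinIndep : ∀ {m} → LinIndep (unit {m})
  unit-LinIndep {m} a a·unit≈0 i = trans (sym (sumF-*unit m a i)) (a·unit≈0 i)

  InSpan-resp : ∀ {m n} (b : Fin m → Vec n) {x y : Vec n} → x ≈v y → InSpan b x → InSpan b y
  InSpan-resp b x≈y (a , x≈ab) = a , ≈v-trans (≈v-sym x≈y) x≈ab

  InSpan-member : ∀ {m n} (b : Fin m → Vec n) (i : Fin m) → InSpan b (b i)
  InSpan-member {m} b i = (λ l → unit l i) , λ j →
    sym (trans (sumF-cong m (λ l → *-comm _ _)) (sumF-*unit m (λ l → b l j) i))

  InSpan-lincomb : ∀ {m p n} (b : Fin p → Vec n) (a : Fin m → Carrier) (v : Fin m → Vec n) →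
    (∀ i → InSpan b (v i)) → InSpan b (lincomb a v)
  InSpan-lincomb {m} b a v v∈b = (λ l → sumF m (λ i → a i * proj₁ (v∈b i) l)) ,
    ≈v-trans (lincomb-cong (λ i → refl) (λ i → proj₂ (v∈b i))) (lincomb-assoc a (λ i → proj₁ (v∈b i)) b)

  HasDim-resp : ∀ {n d} {K : Subset n} → HasDim K d → K Respects _≈v_
  HasDim-resp (b , _ , b-spans) {x} {y} x≈y x∈K = proj₂ (b-spans y) (InSpan-resp b x≈y (proj₁ (b-spans x) x∈K))

  LinIndep-resp : ∀ {m n} {v v′ : Fin m → Vec n} → (∀ i → v i ≈v v′ i) → LinIndep v → LinIndep v′
  LinIndep-resp v≈v′ v-indep a rel = v-indep a (≈v-trans (lincomb-cong (λ i → refl) v≈v′) rel)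

  lincomb-injective : ∀ {m n} (v : Fin m → Vec n) → LinIndep v →
    ∀ {a b} → lincomb a v ≈v lincomb b v → ∀ i → a i ≈ b i
  lincomb-injective {m} v v-indep {a} {b} av≈bv i = x∙y⁻¹≈ε⇒x≈y (a i) (b i) (v-indep (λ i → a i - b i) rel i)
    where
    rel : lincomb (λ i → a i - b i) v ≈v zeroV
    rel j = begin
      sumF m (λ i → (a i - b i) * v i j)                  ≈⟨ sumF-cong m (λ i → [y-z]x≈yx-zx (v i j) (a i) (b i)) ⟩
      sumF m (λ i → a i * v i j + - (b i * v i j))        ≈⟨ sumF-+ m (λ i → a i * v i j) (λ i → - (b i * v i j)) ⟩
      lincomb a v j + sumF m (λ i → - (b i * v i j))      ≈⟨ +-congˡ (sym (sumF-neg m (λ i → b i * v i j))) ⟩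
      lincomb a v j - lincomb b v j                       ≈⟨ +-congʳ (av≈bv j) ⟩
      lincomb b v j - lincomb b v j                       ≈⟨ -‿inverseʳ _ ⟩
      0#                                                  ∎

  LinIndep-fromRestriction : ∀ {m n n′} (v : Fin m → Vec n) (f : Fin n′ → Fin n) →
    LinIndep (λ i → v i ∘ f) → LinIndep v
  LinIndep-fromRestriction v f restriction-indep a rel = restriction-indep a (rel ∘ f)

  lincomb-head : ∀ {p n} (v : Fin (suc p) → Vec n) → lincomb (1# ∷ λ _ → 0#) v ≈v head v
  lincomb-head {p} v j = begin
    1# * head v j + sumF p (λ i → 0# * v (fsuc i) j) ≈⟨ +-cong (*-identityˡ _) (sumF-zero p (λ i → zeroˡ _)) ⟩
    head v j + 0#                                    ≈⟨ +-identityʳ _ ⟩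
    head v j                                         ∎

  LinIndep-head : ∀ {p n} (v : Fin (suc p) → Vec n) → LinIndep v → ¬ (head v ≈v zeroV)
  LinIndep-head v v-indep v₀≈0 = 1≉0 (v-indep (1# ∷ λ _ → 0#) (≈v-trans (lincomb-head v) v₀≈0) fzero)

  LinIndep-tail : ∀ {p n} (v : Fin (suc p) → Vec n) → LinIndep v → LinIndep (tail v)
  LinIndep-tail v v-indep a rel i = v-indep (0# ∷ a) rel′ (fsuc i)
    where
    rel′ : lincomb (0# ∷ a) v ≈v zeroV
    rel′ j = trans (+-cong (zeroˡ (head v j)) (rel j)) (+-identityʳ 0#)

  LinIndep-∷ : ∀ {m n} (v : Vec n) (b : Fin m → Vec n) → LinIndep b → ¬ InSpan b v → LinIndep (v ∷ b)
  LinIndep-∷ {m} v b b-indep v∉b a rel with head a ≈? 0#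
  ... | yes a₀≈0 = λ { fzero → a₀≈0 ; (fsuc i) → b-indep (tail a) rel-tail i }
    where
    rel-tail : lincomb (tail a) b ≈v zeroV
    rel-tail j = trans (sym (trans (+-congʳ (trans (*-congʳ a₀≈0) (zeroˡ (v j)))) (+-identityˡ _))) (rel j)
  ... | no a₀≉0  = ⊥-elim (v∉b ((λ i → - a₀⁻¹ * a (fsuc i)) , v≈ab))
    where
    a₀⁻¹ = proj₁ (inverse (head a) a₀≉0)
    a₀a₀⁻¹≈1 = proj₂ (inverse (head a) a₀≉0)
    v≈ab : v ≈v lincomb (λ i → - a₀⁻¹ * a (fsuc i)) b
    v≈ab j = sym (begin
      sumF m (λ i → (- a₀⁻¹ * a (fsuc i)) * b i j)     ≈⟨ sumF-cong m (λ i → *-assoc _ _ _) ⟩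
      sumF m (λ i → - a₀⁻¹ * (a (fsuc i) * b i j))     ≈⟨ sym (sumF-*ˡ m (- a₀⁻¹) _) ⟩
      - a₀⁻¹ * S                                       ≈⟨ sym (+-identityʳ _) ⟩
      - a₀⁻¹ * S + 0#                                  ≈⟨ +-congˡ (sym (trans (*-congˡ (rel j)) (zeroʳ a₀⁻¹))) ⟩
      - a₀⁻¹ * S + a₀⁻¹ * (head a * v j + S)           ≈⟨ cancel-S a₀⁻¹ (head a) (v j) S ⟩
      (head a * a₀⁻¹) * v j                            ≈⟨ *-congʳ a₀a₀⁻¹≈1 ⟩
      1# * v j                                         ≈⟨ *-identityˡ (v j) ⟩
      v j                                              ∎)
      where
      S = lincomb (tail a) b j
      cancel-S : ∀ x⁻¹ x y s → - x⁻¹ * s + x⁻¹ * (x * y + s) ≈ (x * x⁻¹) * y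
      cancel-S = solve 4 (λ x⁻¹ x y s → :- x⁻¹ :* s :+ x⁻¹ :* (x :* y :+ s) := (x :* x⁻¹) :* y) refl

  LinIndep-[_] : ∀ {n} {w : Vec n} → ¬ (w ≈v zeroV) → LinIndep (w ∷ [])
  LinIndep-[_] {w = w} w≉0 = LinIndep-∷ w [] (λ a rel ()) (λ (_ , w≈0) → w≉0 w≈0)

  suffix : ∀ {m p} → m ≤′ p → Fin m → Fin p
  suffix ≤′-refl        = λ i → i
  suffix (≤′-step m≤′p) = fsuc ∘ suffix m≤′p

  LinIndep-suffix : ∀ {m p n} (m≤′p : m ≤′ p) (v : Fin p → Vec n) → LinIndep v → LinIndep (v ∘ suffix m≤′p)
  LinIndep-suffix ≤′-refl        v v-indep = v-indep
  LinIndep-suffix (≤′-step m≤′p) v v-indep = LinIndep-suffix m≤′p (tail v) (LinIndep-tail v v-indep)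

  -- Exhaustive search over F^m

  searchCarrier : ∀ {p} (P : Carrier → Set p) → P Respects _≈_ → U.Decidable P → Dec (Σ Carrier P)
  searchCarrier P P-resp P? with Fin.any? (P? ∘ enum)
  ... | yes (i , P[eᵢ]) = yes (enum i , P[eᵢ])
  ... | no ∄i           = no λ (x , Px) → let (i , eᵢ≈x) = enum-surjective x in ∄i (i , P-resp (sym eᵢ≈x) Px)

  searchVec : ∀ {p} m (P : Vec m → Set p) → P Respects _≈v_ → U.Decidable P → Dec (Σ (Vec m) P)
  searchVec zero P P-resp P? with P? []
  ... | yes P[] = yes ([] , P[])
  ... | no ¬P[] = no λ (x , Px) → ¬P[] (P-resp (λ ()) Px)
  searchVec (suc m) P P-resp P? with searchCarrier (λ h → Σ (Vec m) (λ t → P (h ∷ t))) resp-head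
      (λ h → searchVec m (λ t → P (h ∷ t)) (λ t≈t′ → P-resp (λ { fzero → refl ; (fsuc i) → t≈t′ i })) (P? ∘ (h ∷_)))
    where
    resp-head : (λ h → Σ (Vec m) (λ t → P (h ∷ t))) Respects _≈_
    resp-head h≈h′ (t , P[h∷t]) = t , P-resp (λ { fzero → h≈h′ ; (fsuc i) → refl }) P[h∷t]
  ... | yes (h , t , P[h∷t]) = yes (h ∷ t , P[h∷t])
  ... | no ∄h∷t              = no λ (x , Px) →
    ∄h∷t (head x , tail x , P-resp (λ { fzero → refl ; (fsuc i) → refl }) Px)

  InSpan? : ∀ {m n} (b : Fin m → Vec n) → U.Decidable (InSpan b)
  InSpan? {m} b w = searchVec m (λ a → w ≈v lincomb a b)
    (λ a≈a′ w≈ab → ≈v-trans w≈ab (lincomb-cong a≈a′ (λ i → ≈v-refl)))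
    (λ a → Fin.all? (λ j → w j ≈? lincomb a b j))

  isZero? : ∀ {m} → U.Decidable (λ (x : Vec m) → x ≈v zeroV)
  isZero? x = Fin.all? (λ j → x j ≈? 0#)

  nonzero-entry : ∀ {m} (x : Vec m) → ¬ (x ≈v zeroV) → ∃ λ j → x j ≉ 0#
  nonzero-entry {m} x x≉0 = Fin.¬∀⟶∃¬ m _ (λ j → x j ≈? 0#) x≉0

  -- Gaussian elimination

  module Pivot {p m : ℕ} (v : Fin (suc p) → Vec (suc m)) (c : Fin (suc m)) where

    pivot : Carrier
    pivot = head v c

    eliminate : Fin p → Vec (suc m)
    eliminate j x = pivot * v (fsuc j) x - v (fsuc j) c * head v x

    reduced : Fin p → Vec m
    reduced j = eliminate j ∘ punchIn c

    eliminate-pivot : ∀ j → eliminate j c ≈ 0#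
    eliminate-pivot j = solve 2 (λ x y → x :* y :- y :* x := con (ℤ.+ 0)) refl pivot (v (fsuc j) c)

    dot-eliminate : ∀ j (w : Vec (suc m)) →
      dot (eliminate j) w ≈ pivot * dot (v (fsuc j)) w - v (fsuc j) c * dot (head v) w
    dot-eliminate j w = begin
      sumF (suc m) (λ x → (α * vⱼ x - β * v₀ x) * w x)
        ≈⟨ sumF-cong (suc m) (λ x → expand α β (vⱼ x) (v₀ x) (w x)) ⟩
      sumF (suc m) (λ x → α * (vⱼ x * w x) + - β * (v₀ x * w x))
        ≈⟨ sumF-+ (suc m) (λ x → α * (vⱼ x * w x)) (λ x → - β * (v₀ x * w x)) ⟩
      sumF (suc m) (λ x → α * (vⱼ x * w x)) + sumF (suc m) (λ x → - β * (v₀ x * w x))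
        ≈⟨ sym (+-cong (sumF-*ˡ (suc m) α (λ x → vⱼ x * w x)) (sumF-*ˡ (suc m) (- β) (λ x → v₀ x * w x))) ⟩
      α * dot vⱼ w + - β * dot v₀ w
        ≈⟨ +-congˡ (sym (-‿distribˡ-* β _)) ⟩
      α * dot vⱼ w - β * dot v₀ w
        ∎
      where
      α = pivot
      β = v (fsuc j) c
      vⱼ = v (fsuc j)
      v₀ = head v
      expand : ∀ a b x y z → (a * x - b * y) * z ≈ a * (x * z) + - b * (y * z)
      expand = solve 5 (λ a b x y z → (a :* x :- b :* y) :* z := a :* (x :* z) :+ :- b :* (y :* z)) refl

    dot-reduced : ∀ j (w : Vec (suc m)) → dot (reduced j) (w ∘ punchIn c) ≈ dot (eliminate j) w
    dot-reduced j w = begin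
      dot (reduced j) (w ∘ punchIn c)                         ≈⟨ sym (+-identityˡ _) ⟩
      0# + dot (reduced j) (w ∘ punchIn c)                    ≈⟨ +-congʳ (sym (trans (*-congʳ (eliminate-pivot j)) (zeroˡ (w c)))) ⟩
      eliminate j c * w c + dot (reduced j) (w ∘ punchIn c)   ≈⟨ sym (dot-punchIn c (eliminate j) w) ⟩
      dot (eliminate j) w                                     ∎

    liftCoeffs : (Fin p → Carrier) → Fin (suc p) → Carrier
    liftCoeffs γ = (- sumF p (λ j → γ j * v (fsuc j) c)) ∷ (λ j → γ j * pivot)

    lincomb-liftCoeffs : ∀ γ → lincomb (liftCoeffs γ) v ≈v lincomb γ eliminate
    lincomb-liftCoeffs γ x = begin
      (- sumF p (λ j → γ j * v (fsuc j) c)) * head v x + sumF p (λ j → (γ j * pivot) * v (fsuc j) x)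
        ≈⟨ +-comm _ _ ⟩
      sumF p (λ j → (γ j * pivot) * v (fsuc j) x) + (- sumF p (λ j → γ j * v (fsuc j) c)) * head v x
        ≈⟨ +-congˡ (trans (*-congʳ (sumF-neg p _)) (sumF-*ʳ p _ _)) ⟩
      sumF p (λ j → (γ j * pivot) * v (fsuc j) x) + sumF p (λ j → - (γ j * v (fsuc j) c) * head v x)
        ≈⟨ sym (sumF-+ p _ _) ⟩
      sumF p (λ j → (γ j * pivot) * v (fsuc j) x + - (γ j * v (fsuc j) c) * head v x)
        ≈⟨ sumF-cong p (λ j → regroup (γ j) pivot (v (fsuc j) x) (v (fsuc j) c) (head v x)) ⟩
      sumF p (λ j → γ j * eliminate j x) ∎
      where
      regroup : ∀ g a x b y → (g * a) * x + - (g * b) * y ≈ g * (a * x - b * y)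
      regroup = solve 5 (λ g a x b y → (g :* a) :* x :+ (:- (g :* b)) :* y := g :* (a :* x :- b :* y)) refl

    liftCoeffs-relation : ∀ γ → lincomb γ reduced ≈v zeroV → lincomb (liftCoeffs γ) v ≈v zeroV
    liftCoeffs-relation γ rel = ≈v-trans (lincomb-liftCoeffs γ) (≈v-punchIn c at-pivot rel)
      where
      at-pivot : lincomb γ eliminate c ≈ 0#
      at-pivot = sumF-zero p (λ j → trans (*-congˡ (eliminate-pivot j)) (zeroʳ (γ j)))

    module _ (pivot≉0 : pivot ≉ 0#) where

      reduced-LinIndep : LinIndep v → LinIndep reduced
      reduced-LinIndep v-indep γ rel j =
        cancel-nonzeroˡ pivot≉0 (trans (*-comm pivot (γ j)) (v-indep (liftCoeffs γ) (liftCoeffs-relation γ rel) (fsuc j)))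

      restriction-LinIndep : ∀ {t} (w : Fin t → Vec (suc m)) → LinIndep w → (∀ i → head v ⟂ w i) →
        LinIndep (λ i → w i ∘ punchIn c)
      restriction-LinIndep {t} w w-indep v₀⟂w β rel = w-indep β (≈v-punchIn c at-pivot rel)
        where
        s = lincomb β w
        at-pivot : s c ≈ 0#
        at-pivot = cancel-nonzeroˡ pivot≉0 (begin
          pivot * s c                                        ≈⟨ sym (+-identityʳ _) ⟩
          pivot * s c + 0#                                   ≈⟨ +-congˡ (sym (⟂-zeroʳ (head v ∘ punchIn c) rel)) ⟩
          pivot * s c + dot (head v ∘ punchIn c) (s ∘ punchIn c) ≈⟨ sym (dot-punchIn c (head v) s) ⟩
          dot (head v) s                                     ≈⟨ ⟂-lincombʳ (head v) β w v₀⟂w ⟩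
          0#                                                 ∎)

  -- Dimension counting

  Nontrivial : ∀ {p} → (Fin p → Carrier) → Set ℓ
  Nontrivial a = ∃ λ i → a i ≉ 0#

  <⇒dependent : ∀ m p (v : Fin p → Vec m) → m ℕ.< p → Σ (Fin p → Carrier) λ a → Nontrivial a × lincomb a v ≈v zeroV
  <⇒dependent zero    (suc p) v _ = (1# ∷ λ _ → 0#) , (fzero , 1≉0) , λ ()
  <⇒dependent (suc m) (suc p) v (s≤s m<p) with isZero? (head v)
  ... | yes v₀≈0 = (1# ∷ λ _ → 0#) , (fzero , 1≉0) , ≈v-trans (lincomb-head v) v₀≈0
  ... | no v₀≉0  with nonzero-entry (head v) v₀≉0
  ...   | c , pivot≉0 with <⇒dependent m p (Pivot.reduced v c) m<p
  ...     | γ , (i , γᵢ≉0) , rel = liftCoeffs γ , (fsuc i , *-nonzero γᵢ≉0 pivot≉0) , liftCoeffs-relation γ rel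
    where open Pivot v c

  LinIndep-≤ : ∀ N t (w : Fin t → Vec N) → LinIndep w → t ℕ.≤ N
  LinIndep-≤ N t w w-indep with t ℕ.≤? N
  ... | yes t≤N = t≤N
  ... | no  t≰N with <⇒dependent N t w (ℕ.≰⇒> t≰N)
  ...   | a , (i , aᵢ≉0) , rel = ⊥-elim (aᵢ≉0 (w-indep a rel i))

  -- Over a finite field a vector may be orthogonal to itself, so the two families need not span
  -- independent subspaces; the bound comes from eliminating one coordinate per vector of g.
  ⟂-LinIndep-≤ : ∀ N r t (g : Fin r → Vec N) (w : Fin t → Vec N) → LinIndep g → LinIndep w →
    (∀ l i → g l ⟂ w i) → r ℕ.+ t ℕ.≤ N
  ⟂-LinIndep-≤ N       zero    t g w g-indep w-indep g⟂w = LinIndep-≤ N t w w-indep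
  ⟂-LinIndep-≤ zero    (suc r) t g w g-indep w-indep g⟂w = ⊥-elim (LinIndep-head g g-indep (λ ()))
  ⟂-LinIndep-≤ (suc N) (suc r) t g w g-indep w-indep g⟂w with nonzero-entry (head g) (LinIndep-head g g-indep)
  ... | c , pivot≉0 = s≤s (⟂-LinIndep-≤ N r t reduced (λ i → w i ∘ punchIn c)
          (reduced-LinIndep pivot≉0 g-indep) (restriction-LinIndep pivot≉0 w w-indep (g⟂w fzero))
          (λ l i → trans (dot-reduced l (w i)) (eliminated⟂ l i)))
    where
    open Pivot g c
    eliminated⟂ : ∀ l i → eliminate l ⟂ w i
    eliminated⟂ l i = begin
      dot (eliminate l) (w i)
        ≈⟨ dot-eliminate l (w i) ⟩
      pivot * dot (g (fsuc l)) (w i) - g (fsuc l) c * dot (head g) (w i)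
        ≈⟨ +-cong (*-congˡ (g⟂w (fsuc l) i)) (-‿cong (*-congˡ (g⟂w fzero i))) ⟩
      pivot * 0# - g (fsuc l) c * 0#
        ≈⟨ x0-y0≈0 pivot (g (fsuc l) c) ⟩
      0#
        ∎
      where
      x0-y0≈0 : ∀ x y → x * 0# - y * 0# ≈ 0#
      x0-y0≈0 = solve 2 (λ x y → x :* con (ℤ.+ 0) :- y :* con (ℤ.+ 0) := con (ℤ.+ 0)) refl

  ⟂-complement : ∀ N d (b : Fin d → Vec N) → LinIndep b →
    Σ (Fin (N ℕ.∸ d) → Vec N) λ z → LinIndep z × (∀ j i → z j ⟂ b i)
  ⟂-complement N       zero    b b-indep = unit , unit-LinIndep , λ j ()
  ⟂-complement zero    (suc d) b b-indep = ⊥-elim (LinIndep-head b b-indep (λ ()))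
  ⟂-complement (suc N) (suc d) b b-indep with nonzero-entry (head b) (LinIndep-head b b-indep)
  ... | c , pivot≉0 with ⟂-complement N d (Pivot.reduced b c) (Pivot.reduced-LinIndep b c pivot≉0 b-indep)
  ...   | z′ , z′-indep , z′⟂reduced = z , z-indep , z⟂b
    where
    open Pivot b c
    pivot⁻¹ = proj₁ (inverse pivot pivot≉0)
    pivotpivot⁻¹≈1 = proj₂ (inverse pivot pivot≉0)
    -- the entry at the pivot column is chosen so that z j ⟂ head b
    z : Fin (N ℕ.∸ d) → Vec (suc N)
    z j = insertAt (z′ j) c (- (pivot⁻¹ * dot (head b ∘ punchIn c) (z′ j)))
    z-restriction : ∀ j → (z j ∘ punchIn c) ≈v z′ j
    z-restriction j y = reflexive (Vector.insertAt-punchIn (z′ j) c _ y)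
    z-indep : LinIndep z
    z-indep = LinIndep-fromRestriction z (punchIn c) (LinIndep-resp (λ j → ≈v-sym (z-restriction j)) z′-indep)
    z⟂b₀ : ∀ j → z j ⟂ head b
    z⟂b₀ j = begin
      dot (z j) (head b)
        ≈⟨ dot-punchIn c (z j) (head b) ⟩
      z j c * pivot + dot (z j ∘ punchIn c) (head b ∘ punchIn c)
        ≈⟨ +-cong (*-congʳ (reflexive (Vector.insertAt-lookup (z′ j) c _)))
                  (trans (dot-congˡ _ (z-restriction j)) (dot-comm (z′ j) _)) ⟩
      - (pivot⁻¹ * D) * pivot + D
        ≈⟨ regroup pivot pivot⁻¹ D ⟩
      D - D * (pivot * pivot⁻¹)
        ≈⟨ +-congˡ (-‿cong (trans (*-congˡ pivotpivot⁻¹≈1) (*-identityʳ D))) ⟩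
      D - D
        ≈⟨ -‿inverseʳ D ⟩
      0#
        ∎
      where
      D = dot (head b ∘ punchIn c) (z′ j)
      regroup : ∀ x x⁻¹ d → - (x⁻¹ * d) * x + d ≈ d - d * (x * x⁻¹)
      regroup = solve 3 (λ x x⁻¹ d → :- (x⁻¹ :* d) :* x :+ d := d :- d :* (x :* x⁻¹)) refl
    eliminated⟂z : ∀ i j → eliminate i ⟂ z j
    eliminated⟂z i j = begin
      dot (eliminate i) (z j)                  ≈⟨ sym (dot-reduced i (z j)) ⟩
      dot (reduced i) (z j ∘ punchIn c)        ≈⟨ dot-congʳ (reduced i) (z-restriction j) ⟩
      dot (reduced i) (z′ j)                   ≈⟨ ⟂-sym (z′ j) (reduced i) (z′⟂reduced j i) ⟩
      0#                                       ∎
    z⟂b : ∀ j i → z j ⟂ b i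
    z⟂b j fzero    = z⟂b₀ j
    z⟂b j (fsuc i) = ⟂-sym (b (fsuc i)) (z j) (cancel-nonzeroˡ pivot≉0 (begin
      pivot * dot bᵢ (z j)
        ≈⟨ x≈[x-e]+e (pivot * dot bᵢ (z j)) E ⟩
      (pivot * dot bᵢ (z j) - E) + E
        ≈⟨ +-cong (sym (dot-eliminate i (z j))) (*-congˡ (⟂-sym (z j) (head b) (z⟂b₀ j))) ⟩
      dot (eliminate i) (z j) + b (fsuc i) c * 0#
        ≈⟨ +-cong (eliminated⟂z i j) (zeroʳ _) ⟩
      0# + 0#
        ≈⟨ +-identityʳ 0# ⟩
      0#
        ∎))
      where
      bᵢ = b (fsuc i)
      E = b (fsuc i) c * dot (head b) (z j)
      x≈[x-e]+e : ∀ x e → x ≈ (x - e) + e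
      x≈[x-e]+e = solve 2 (λ x e → x := (x :- e) :+ e) refl

  normal-vector : ∀ {m N} → m ℕ.< N → (g : Fin m → Vec N) → Σ (Vec N) λ w → ¬ (w ≈v zeroV) × (∀ i → g i ⟂ w)
  normal-vector {m} {N} m<N g with <⇒dependent m N (λ x i → g i x) m<N
  ... | w , (x , wₓ≉0) , rel = w , (λ w≈0 → wₓ≉0 (w≈0 x)) , (λ i → trans (dot-comm (g i) w) (rel i))

  hyperplane-InSpan : ∀ {k} (g : Fin k → Vec (suc k)) {w a : Vec (suc k)} → LinIndep g → ¬ (w ≈v zeroV) →
    (∀ i → g i ⟂ w) → a ⟂ w → InSpan g a
  hyperplane-InSpan {k} g {w} {a} g-indep w≉0 g⟂w a⟂w with InSpan? g a
  ... | yes a∈g = a∈g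
  ... | no  a∉g = ⊥-elim (ℕ.m+1+n≰m (suc k) (⟂-LinIndep-≤ (suc k) (suc k) 1 (a ∷ g) (w ∷ [])
          (LinIndep-∷ a g g-indep a∉g) LinIndep-[ w≉0 ] a∷g⟂w))
    where
    a∷g⟂w : ∀ l i → (a ∷ g) l ⟂ (w ∷ []) i
    a∷g⟂w fzero    fzero = a⟂w
    a∷g⟂w (fsuc l) fzero = g⟂w l

  module _ {N : ℕ} (P : Subset N) (P-resp : P Respects _≈v_) (P? : U.Decidable P) where

    private
      Extends : ∀ {d} → (Fin d → Vec N) → Vec N → Set (c ⊔ ℓ)
      Extends b w = P w × ¬ InSpan b w

      Extends? : ∀ {d} (b : Fin d → Vec N) → Dec (Σ (Vec N) (Extends b))
      Extends? b = searchVec N (Extends b)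
        (λ w≈w′ (Pw , w∉b) → P-resp w≈w′ Pw , λ w′∈b → w∉b (InSpan-resp b (≈v-sym w≈w′) w′∈b))
        (λ w → P? w ×-dec ¬? (InSpan? b w))

    SpanOf-basis : ∀ {d} (b : Fin d → Vec N) → LinIndep b → (∀ i → P (b i)) → (∀ w → P w → InSpan b w) →
      HasDim (SpanOf P) d
    SpanOf-basis {d} b b-indep b∈P P⊆b = b , b-indep , λ x →
      (λ (m , v , v∈P , x∈v) → InSpan-resp b (≈v-sym (proj₂ x∈v))
                                 (InSpan-lincomb b (proj₁ x∈v) v (λ i → P⊆b (v i) (v∈P i)))) ,
      (λ x∈b → d , b , b∈P , x∈b)

    -- Greedy extension by vectors of P outside the current span; as m < fuel + d is kept, running
    -- out of fuel contradicts the bound.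
    SpanOf-dim-≤ : ∀ m → (∀ e (v : Fin e → Vec N) → LinIndep v → (∀ i → P (v i)) → e ℕ.≤ m) →
      Σ ℕ λ d → d ℕ.≤ m × HasDim (SpanOf P) d
    SpanOf-dim-≤ m bounded = extend (suc m) [] (λ a rel ()) (λ ()) (ℕ.m≤m+n (suc m) 0)
      where
      extend : ∀ fuel {d} (b : Fin d → Vec N) → LinIndep b → (∀ i → P (b i)) → m ℕ.< fuel ℕ.+ d →
        Σ ℕ λ d → d ℕ.≤ m × HasDim (SpanOf P) d
      extend zero       b b-indep b∈P m<d = ⊥-elim (ℕ.<⇒≱ m<d (bounded _ b b-indep b∈P))
      extend (suc fuel) {d} b b-indep b∈P m<fuel+d with Extends? b
      ... | yes (w , Pw , w∉b) = extend fuel (w ∷ b) (LinIndep-∷ w b b-indep w∉b)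
              (λ { fzero → Pw ; (fsuc i) → b∈P i }) (≡.subst (m ℕ.<_) (≡.sym (ℕ.+-suc fuel d)) m<fuel+d)
      ... | no  ∄w             = d , bounded d b b-indep b∈P , SpanOf-basis b b-indep b∈P P⊆b
        where
        P⊆b : ∀ w → P w → InSpan b w
        P⊆b w Pw with InSpan? b w
        ... | yes w∈b = w∈b
        ... | no  w∉b = ⊥-elim (∄w (w , Pw , w∉b))

  Proportional? : ∀ {m} (u v : Vec m) → Dec (Proportional u v)
  Proportional? u v = searchCarrier (λ a → ∀ i → u i ≈ a * v i)
    (λ a≈b u≈av i → trans (u≈av i) (*-congʳ a≈b)) (λ a → Fin.all? (λ i → u i ≈? a * v i))

  W′-resp : ∀ {k n} (M : Fin k → Vec n) → W′ M Respects _≈v_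
  W′-resp M w≈w′ (w≉0 , w∉col) =
    (λ w′≈0 → w≉0 (≈v-trans w≈w′ w′≈0)) , λ j (a , w′≈a·colⱼ) → w∉col j (a , ≈v-trans w≈w′ w′≈a·colⱼ)

  W′? : ∀ {k n} (M : Fin k → Vec n) → U.Decidable (W′ M)
  W′? M w = ¬? (isZero? w) ×-dec Fin.all? (λ j → ¬? (Proportional? w (column M j)))

k∸1+e≤1+k⇒e≤2 : ∀ k e → k ℕ.∸ 1 ℕ.+ e ℕ.≤ suc k → e ℕ.≤ 2
k∸1+e≤1+k⇒e≤2 zero    e e≤1   = ℕ.m≤n⇒m≤1+n e≤1
k∸1+e≤1+k⇒e≤2 (suc k) e k+e≤2+k = ℕ.+-cancelˡ-≤ k e 2 (≡.subst (k ℕ.+ e ℕ.≤_) (ℕ.+-comm 2 k) k+e≤2+k)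

module Codes {c ℓ : Level} (F : FiniteField c ℓ) {k n : ℕ} {U : LinAlg.Subset F n}
    (M : Fin (suc k) → LinAlg.Vec F n) (M-basis : LinAlg.IsBasis F M U) (U-nondeg : LinAlg.NonDegenerate F U) where
  open LinearAlgebra F

  φ : Vec (suc k) → Vec n
  φ a = lincomb a M

  φ-lincomb : ∀ {m} (α : Fin m → Carrier) (g : Fin m → Vec (suc k)) → lincomb α (φ ∘ g) ≈v φ (lincomb α g)
  φ-lincomb α g = lincomb-assoc α g M

  φ-injective : ∀ {a b} → φ a ≈v φ b → a ≈v b
  φ-injective = lincomb-injective M (proj₁ M-basis)

  U-coords : ∀ {x} → U x → Σ (Vec (suc k)) λ a → x ≈v φ a
  U-coords {x} = proj₁ (proj₂ M-basis x)

  InSpan-φ⇒U : ∀ {m} (z : Fin m → Vec (suc k)) {x} → InSpan (φ ∘ z) x → U x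
  InSpan-φ⇒U z {x} (α , x≈αφz) = proj₂ (proj₂ M-basis x) (lincomb α z , ≈v-trans x≈αφz (φ-lincomb α z))

  InSpan-φ : ∀ {m} {g : Fin m → Vec (suc k)} {h : Fin m → Vec n} {a} →
    (∀ i → h i ≈v φ (g i)) → InSpan g a → InSpan h (φ a)
  InSpan-φ {g = g} {h} {a} h≈φg (δ , a≈δg) = δ , λ j → begin
    φ a j                   ≈⟨ lincomb-cong {v = M} a≈δg (λ i → ≈v-refl) j ⟩
    φ (lincomb δ g) j       ≈⟨ sym (φ-lincomb δ g j) ⟩
    lincomb δ (φ ∘ g) j     ≈⟨ lincomb-cong {a = δ} (λ i → refl) (λ i → ≈v-sym (h≈φg i)) j ⟩
    lincomb δ h j           ∎

  φ-LinIndep : ∀ {m} (g : Fin m → Vec (suc k)) → LinIndep g → LinIndep (φ ∘ g)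
  φ-LinIndep g g-indep α rel = g-indep α (λ i → proj₁ M-basis (lincomb α g) (≈v-trans (≈v-sym (φ-lincomb α g)) rel) i)

  φ-LinIndep⁻ : ∀ {m} (h : Fin m → Vec n) (g : Fin m → Vec (suc k)) → (∀ i → h i ≈v φ (g i)) →
    LinIndep h → LinIndep g
  φ-LinIndep⁻ h g h≈φg h-indep α rel = h-indep α (λ j → begin
    lincomb α h j          ≈⟨ lincomb-cong (λ i → refl) h≈φg j ⟩
    lincomb α (φ ∘ g) j    ≈⟨ φ-lincomb α g j ⟩
    φ (lincomb α g) j      ≈⟨ trans (dot-comm (lincomb α g) (column M j)) (⟂-zeroʳ (column M j) rel) ⟩
    0#                     ∎)

  column-nonzero : ∀ j → ¬ (column M j ≈v zeroV)
  column-nonzero j colⱼ≈0 = U-nondeg j λ x x∈U →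
    let (a , x≈φa) = U-coords x∈U in lift (trans (x≈φa j) (⟂-zeroʳ a colⱼ≈0))

  module Hyperplane {w : Vec (suc k)} (w∈W′ : W′ M w) where

    private
      complement = ⟂-complement (suc k) 1 (w ∷ []) LinIndep-[ proj₁ w∈W′ ]

    z : Fin k → Vec (suc k)
    z = proj₁ complement

    z⟂w : ∀ l → z l ⟂ w
    z⟂w l = proj₂ (proj₂ complement) l fzero

    K : Subset n
    K = InSpan (φ ∘ z)

    K⊆U : K ⊆ U
    K⊆U x = InSpan-φ⇒U z

    K-coords⟂ : ∀ {y} a → y ≈v φ a → K y → a ⟂ w
    K-coords⟂ a y≈φa (α , y≈αφz) = begin
      dot a w               ≈⟨ dot-congˡ w (φ-injective {a} {lincomb α z} φa≈φαz) ⟩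
      dot (lincomb α z) w   ≈⟨ ⟂-lincombˡ α z w z⟂w ⟩
      0#                    ∎
      where
      φa≈φαz : φ a ≈v φ (lincomb α z)
      φa≈φαz = ≈v-trans (≈v-sym y≈φa) (≈v-trans y≈αφz (φ-lincomb α z))

    -- (φ a) j is dot a (column M j), so K ⊆ C j makes column j orthogonal to every z l,
    -- and the k independent vectors z l cannot be orthogonal to two independent vectors.
    K-nondeg : NonDegenerate K
    K-nondeg j K⊆Cⱼ = ℕ.n≮n (suc k) (⟂-LinIndep-≤ (suc k) 2 k (w ∷ column M j ∷ []) z
      w,colⱼ-indep (proj₁ (proj₂ complement)) w,colⱼ⟂z)
      where
      w,colⱼ-indep : LinIndep (w ∷ column M j ∷ [])
      w,colⱼ-indep = LinIndep-∷ w (column M j ∷ []) LinIndep-[ column-nonzero j ]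
        (λ (a , w≈a·colⱼ) → proj₂ w∈W′ j (head a , λ i → trans (w≈a·colⱼ i) (+-identityʳ _)))
      w,colⱼ⟂z : ∀ i l → (w ∷ column M j ∷ []) i ⟂ z l
      w,colⱼ⟂z fzero        l = ⟂-sym (z l) w (z⟂w l)
      w,colⱼ⟂z (fsuc fzero) l = ⟂-sym (z l) (column M j) (lower (K⊆Cⱼ _ (InSpan-member (φ ∘ z) l)))

    K-code : NonDegSubOf U k K
    K-code = (φ ∘ z , φ-LinIndep z (proj₁ (proj₂ complement)) , λ x → id , id) , K⊆U , K-nondeg

  normal∈W′ : ∀ {K : Subset n} (h : Fin k → Vec n) (g : Fin k → Vec (suc k)) {w : Vec (suc k)} →
    (∀ x → K x → InSpan h x) → (∀ i → h i ≈v φ (g i)) → ¬ (w ≈v zeroV) → (∀ i → g i ⟂ w) →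
    NonDegenerate K → W′ M w
  normal∈W′ {K} h g {w} K⊆h h≈φg w≉0 g⟂w K-nondeg = w≉0 , λ j (λ₀ , w≈λ₀colⱼ) → K-nondeg j (K⊆Cⱼ j λ₀ w≈λ₀colⱼ)
    where
    K⊆Cⱼ : ∀ j λ₀ → (∀ i → w i ≈ λ₀ * column M j i) → K ⊆ C j
    K⊆Cⱼ j λ₀ w≈λ₀colⱼ y y∈K = lift (cancel-nonzeroˡ λ₀≉0 (begin
      λ₀ * y j                                 ≈⟨ *-congˡ (trans (y≈βh j) (trans (lincomb-cong {a = β} (λ i → refl) h≈φg j) (φ-lincomb β g j))) ⟩
      λ₀ * dot a (column M j)                  ≈⟨ sumF-*ˡ (suc k) λ₀ (λ i → a i * column M j i) ⟩
      sumF (suc k) (λ i → λ₀ * (a i * column M j i))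
                                               ≈⟨ sumF-cong (suc k) (λ i → trans (x∙yz≈y∙xz λ₀ (a i) _) (*-congˡ (sym (w≈λ₀colⱼ i)))) ⟩
      dot a w                                  ≈⟨ ⟂-lincombˡ β g w g⟂w ⟩
      0#                                       ∎))
      where
      β = proj₁ (K⊆h y y∈K)
      y≈βh = proj₂ (K⊆h y y∈K)
      a = lincomb β g
      λ₀≉0 : λ₀ ≉ 0#
      λ₀≉0 λ₀≈0 = w≉0 (λ i → trans (w≈λ₀colⱼ i) (trans (*-congʳ λ₀≈0) (zeroˡ _)))

  contained-in-line⇒dim-W-≤2 : ContainedInLine k (NonDegSubOf U k) → Σ ℕ λ d → d ℕ.≤ 2 × HasDim (W M) d
  contained-in-line⇒dim-W-≤2 (S , T , (s , s-indep , s-spans) , _ , _ , line) =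
    SpanOf-dim-≤ (W′ M) (W′-resp M) (W′? M) 2 W′-LinIndep-≤2
    where
    W′-LinIndep-≤2 : ∀ e (v : Fin e → Vec (suc k)) → LinIndep v → (∀ i → W′ M (v i)) → e ℕ.≤ 2
    W′-LinIndep-≤2 zero    v v-indep v∈W′ = z≤n
    W′-LinIndep-≤2 (suc e) v v-indep v∈W′ =
      k∸1+e≤1+k⇒e≤2 k (suc e) (⟂-LinIndep-≤ (suc k) (k ℕ.∸ 1) (suc e) g v g-indep v-indep g⟂v)
      where
      s∈K : ∀ i l → Hyperplane.K (v∈W′ i) (s l)
      s∈K i l = proj₁ (proj₂ (line _ (Hyperplane.K-code (v∈W′ i)))) (s l) (proj₂ (s-spans (s l)) (InSpan-member s l))
      coords : ∀ l → Σ (Vec (suc k)) λ a → s l ≈v φ a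
      coords l = U-coords (Hyperplane.K⊆U (v∈W′ fzero) (s l) (s∈K fzero l))
      g = proj₁ ∘ coords
      g-indep = φ-LinIndep⁻ s g (proj₂ ∘ coords) s-indep
      g⟂v : ∀ l i → g l ⟂ v i
      g⟂v l i = Hyperplane.K-coords⟂ (v∈W′ i) (g l) (proj₂ (coords l)) (s∈K i l)

  ⟂W⇒φ∈NonDegSub : ∀ {K} → NonDegSubOf U k K → ∀ a → (∀ w → W M w → a ⟂ w) → K (φ a)
  ⟂W⇒φ∈NonDegSub {K} ((h , h-indep , h-spans) , K⊆U , K-nondeg) a a⟂W =
    proj₂ (h-spans (φ a)) (InSpan-φ {a = a} h≈φg (hyperplane-InSpan g g-indep w≉0 g⟂w (a⟂W w w∈W)))
    where
    coords : ∀ i → Σ (Vec (suc k)) λ a → h i ≈v φ a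
    coords i = U-coords (K⊆U (h i) (proj₂ (h-spans (h i)) (InSpan-member h i)))
    g = proj₁ ∘ coords
    h≈φg = proj₂ ∘ coords
    g-indep = φ-LinIndep⁻ h g h≈φg h-indep
    w = proj₁ (normal-vector (ℕ.n<1+n k) g)
    w≉0 = proj₁ (proj₂ (normal-vector (ℕ.n<1+n k) g))
    g⟂w = proj₂ (proj₂ (normal-vector (ℕ.n<1+n k) g))
    w∈W : W M w
    w∈W = 1 , w ∷ [] , (λ { fzero → normal∈W′ h g (λ y → proj₁ (h-spans y)) h≈φg w≉0 g⟂w K-nondeg }) ,
          InSpan-member (w ∷ []) fzero

  dim-W-≤2⇒contained-in-line : Σ ℕ (λ d → d ℕ.≤ 2 × HasDim (W M) d) → ContainedInLine k (NonDegSubOf U k)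
  dim-W-≤2⇒contained-in-line (d , d≤2 , b , b-indep , b-spans) =
    S , U , S-dim , (M , M-basis) , (λ x → InSpan-φ⇒U z) ,
    λ K K-code@(K-dim , K⊆U , _) → K-dim , S⊆K K-code , K⊆U
    where
    complement = ⟂-complement (suc k) d b b-indep
    z≤′complement : k ℕ.∸ 1 ≤′ suc k ℕ.∸ d
    z≤′complement = ℕ.≤⇒≤′ (ℕ.∸-monoʳ-≤ (suc k) d≤2)
    z : Fin (k ℕ.∸ 1) → Vec (suc k)
    z = proj₁ complement ∘ suffix z≤′complement
    z⟂W : ∀ l w → W M w → z l ⟂ w
    z⟂W l w w∈W = let (β , w≈βb) = proj₁ (b-spans w) w∈W in
      trans (dot-congʳ (z l) w≈βb) (⟂-lincombʳ (z l) β b (proj₂ (proj₂ complement) (suffix z≤′complement l)))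
    S : Subset n
    S = InSpan (φ ∘ z)
    S-dim : HasDim S (k ℕ.∸ 1)
    S-dim = φ ∘ z , φ-LinIndep z (LinIndep-suffix z≤′complement _ (proj₁ (proj₂ complement))) , λ x → id , id
    S⊆K : ∀ {K} → NonDegSubOf U k K → S ⊆ K
    S⊆K {K} K-code x (α , x≈αφz) = K-resp (≈v-sym (≈v-trans x≈αφz (φ-lincomb α z)))
      (⟂W⇒φ∈NonDegSub K-code (lincomb α z) (λ w w∈W → ⟂-lincombˡ α z w (λ l → z⟂W l w w∈W)))
      where
      K-resp : K Respects _≈v_
      K-resp = HasDim-resp (proj₁ K-code)

  contained-in-line⇔dim-W-≤2 : ContainedInLine k (NonDegSubOf U k) ⇔ Σ ℕ (λ d → d ℕ.≤ 2 × HasDim (W M) d)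
  contained-in-line⇔dim-W-≤2 = mk⇔ contained-in-line⇒dim-W-≤2 dim-W-≤2⇒contained-in-line

theorem1 : ∀ {c ℓ : Level} (F : FiniteField c ℓ) →
    let open FiniteField F using (q) in
    let open LinAlg F in
    IsPrimePower q →
    ∀ (k n : ℕ) → 2 ≤ k → suc (suc k) ≤ n →
    ∀ (U : Subset n) (M : Fin (suc k) → Vec n) →
    IsBasis M U → NonDegenerate U →
    ContainedInLine k (NonDegSubOf U k) ⇔ Σ ℕ (λ d → d ≤ 2 × HasDim (W M) d)
theorem1 F _ k n _ _ U M M-basis U-nondeg = Codes.contained-in-line⇔dim-W-≤2 F M M-basis U-nondeg
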